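{- For integers $2\le\Delta\le n-1$, $$H(B_{n,\Delta})=n\,H_{n-\Delta}-n+\Delta+\frac{(\Delta-1)(\Delta-2)}{4}+\frac{\Delta-1}{n-\Delta+1},$$ where $H_k=1+\frac12+\dots+\frac1k$ is the $k$-th harmonic number.
   Context: The Harary index of a connected graph $G$ is $H(G)=\sum_{\{x,y\}\subseteq V(G),\,x\ne y}\frac{1}{d(x,y)}$, $d$ the shortest-path distance. The broom $B_{n,\Delta}$ is the tree on $n$ vertices consisting of a star $S_{\Delta+1}$ and a path of length $n-\Delta-1$ attached at one pendent vertex of the star. -}

module Defs where

open import Data.Bool using (Bool; true; false; _∧_; _∨_; if_then_else_)
open import Data.Nat using (ℕ; zero; suc; _∸_; _≡ᵇ_; _<ᵇ_; _≤ᵇ_) renaming (_+_ to _+ℕ_)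
open import Data.Fin using (Fin; toℕ)
open import Data.List using (List; []; _∷_; map; concatMap; foldr; allFin)
open import Data.Bool.ListAction using (any)
open import Data.Product using (_×_; _,_)
open import Data.Integer using (+_)
open import Data.Rational using (ℚ; _/_; 0ℚ; _+_)

Graph : ℕ → Set
Graph n = Fin n → Fin n → Bool

within : ∀ {n} → Graph n → ℕ → Fin n → Fin n → Bool
within {n} G zero    x y = toℕ x ≡ᵇ toℕ y
within {n} G (suc k) x y = within G k x y ∨ any (λ z → within G k x z ∧ G z y) (allFin n)

-- least k ≥ start (trying `fuel` values) with within G k x y; returns start+fuel if none.
leastFrom : ∀ {n} → Graph n → Fin n → Fin n → ℕ → ℕ → ℕ
leastFrom G x y k zero = k
leastFrom G x y k (suc fuel) with within G k x y
... | true  = k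
... | false = leastFrom G x y (suc k) fuel

-- Shortest-path distance d(x,y): the least k such that some walk of length ≤ k
-- joins x and y.  In a connected graph on n vertices d(x,y) ≤ n-1, so searching
-- k ∈ {0,…,n-1} suffices.
dist : ∀ {n} → Graph n → Fin n → Fin n → ℕ
dist {n} G x y = leastFrom G x y 0 n

-- 1/d as a rational (d ≥ 1 for distinct vertices; the 0 case never occurs there).
recip : ℕ → ℚ
recip zero    = 0ℚ
recip (suc k) = (+ 1) / suc k

sumℚ : List ℚ → ℚ
sumℚ = foldr _+_ 0ℚ

pairs : ∀ n → List (Fin n × Fin n)
pairs n = concatMap (λ x → concatMap (λ y → if (toℕ x <ᵇ toℕ y) then (x , y) ∷ [] else []) (allFin n)) (allFin n)

harary : ∀ {n} → Graph n → ℚ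
harary {n} G = sumℚ (map (λ p → recip (dist G (Data.Product.proj₁ p) (Data.Product.proj₂ p))) (pairs n))
  where import Data.Product

harmonic : ℕ → ℚ
harmonic zero    = 0ℚ
harmonic (suc k) = harmonic k + recip (suc k)

-- Broom B_{n,Δ} on vertices 0,…,n-1:
--   vertices 0,1,…,n-Δ form a path (i ~ i+1); vertex 0 is the star centre,
--   vertex 1 is the pendent star vertex at which the path 1,2,…,n-Δ
--   (of length n-Δ-1) is attached, and vertices n-Δ+1,…,n-1 are the other
--   Δ-1 leaves of the star, adjacent to 0.  So the star S_{Δ+1} has centre 0
--   and leaves {1} ∪ {n-Δ+1,…,n-1}.
broomEdge : ℕ → ℕ → ℕ → ℕ → Bool
broomEdge n Δ i j =
  ((suc i ≡ᵇ j) ∧ (j ≤ᵇ (n ∸ Δ)))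
  ∨ ((i ≡ᵇ 0) ∧ ((n ∸ Δ) <ᵇ j))

broom : (n Δ : ℕ) → Graph n
broom n Δ x y = broomEdge n Δ (toℕ x) (toℕ y) ∨ broomEdge n Δ (toℕ y) (toℕ x)

-- In the broom with path 0 … m (m = n - Δ) and extra leaves m+1 … n-1 at the hub 0,
-- distances are explicit: |i - j| along the path, i + 1 from path vertex i to a leaf,
-- and 2 between distinct leaves.  Any function with d(x,x) = 0, d(x,y) ≤ d(x,z) + 1 for
-- an edge zy, and a predecessor z of y with d(x,z) = d(x,y) - 1 whenever d(x,y) > 0
-- agrees with breadth-first search, so this formula is the graph distance.  Summing
-- 1/d(i,j) over i < j column by column, the path column j contributes H_j and the leaf
-- column m+1+t contributes H_{m+1} + t/2; with Σ_{j ≤ m} H_j = (m+1) H_{m+1} - (m+1)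
-- and Σ_{t < Δ-1} t/2 = (Δ-1)(Δ-2)/4 the formula follows by field arithmetic.
module Submission where

open import Defs
open import Data.Nat using (ℕ; _≤_; _∸_)
open import Data.Integer using (+_)
open import Data.Rational using (ℚ; _+_; _-_; _*_; _/_)
open import Relation.Binary.PropositionalEquality using (_≡_)
import Data.Nat

open import Data.Bool using (true; false; if_then_else_; T; _∧_; _∨_)
open import Data.Bool.Properties using (T-≡; T-∨; T-∧)
open import Data.Fin using (Fin; toℕ; fromℕ<)
open import Data.Fin.Properties using (toℕ-injective; toℕ-fromℕ<; toℕ<n)
import Data.Integer as ℤ
import Data.Integer.Properties as ℤ
open import Data.Integer.Tactic.RingSolver using (solve-∀)
open import Data.List using (List; []; _∷_; _++_; map; concatMap; allFin; tabulate)
open import Data.List.Properties using (map-++; map-tabulate; map-cong)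
open import Data.List.Membership.Propositional using (lose)
open import Data.List.Membership.Propositional.Properties using (∈-allFin)
open import Data.List.Relation.Unary.Any using (satisfied)
open import Data.List.Relation.Unary.Any.Properties using (any⁺; any⁻)
open import Data.Nat as ℕ using (zero; suc; _<_; z≤n; s≤s; _<ᵇ_)
import Data.Nat.Properties as ℕ
open import Data.Nat.Tactic.RingSolver using () renaming (solve-∀ to ℕ-solve-∀)
open import Data.Product using (_×_; _,_; proj₁; proj₂; ∃-syntax)
open import Data.Rational using (0ℚ; 1ℚ; fromℚᵘ)
open import Data.Rational.Properties
  using (+-identityˡ; +-identityʳ; +-assoc; +-comm; *-zeroˡ)
  using (fromℚᵘ-cong; toℚᵘ-injective; toℚᵘ-fromℚᵘ; toℚᵘ-homo-+; toℚᵘ-homo-*)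
open import Data.Rational.Solver using (module +-*-Solver)
open +-*-Solver using (solve; _:=_; _:+_; _:*_; _:-_; con)
import Data.Rational.Unnormalised as ℚᵘ
import Data.Rational.Unnormalised.Properties as ℚᵘ
open import Data.Sum using (_⊎_; inj₁; inj₂; [_,_])
open import Function using (_∘_)
open import Function.Bundles using (Equivalence)
open import Relation.Binary.Definitions using (tri<; tri≈; tri>)
open import Relation.Binary.PropositionalEquality using (_≢_; refl; sym; trans; cong; cong₂; subst; module ≡-Reasoning)
open import Relation.Nullary using (¬_; contradiction; yes; no)
open import Relation.Nullary.Decidable using (dec-yes-irr; dec-no)

fromℕ : ℕ → ℚ
fromℕ n = + n / 1

½ ¼ : ℚ
½ = recip 2
¼ = recip 4

fromℚᵘ-homo-+ : ∀ p q → fromℚᵘ (p ℚᵘ.+ q) ≡ fromℚᵘ p + fromℚᵘ q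
fromℚᵘ-homo-+ p q = toℚᵘ-injective (ℚᵘ.≃-trans (toℚᵘ-fromℚᵘ _)
  (ℚᵘ.≃-trans (ℚᵘ.+-cong (ℚᵘ.≃-sym (toℚᵘ-fromℚᵘ p)) (ℚᵘ.≃-sym (toℚᵘ-fromℚᵘ q)))
              (ℚᵘ.≃-sym (toℚᵘ-homo-+ (fromℚᵘ p) (fromℚᵘ q)))))

fromℚᵘ-homo-* : ∀ p q → fromℚᵘ (p ℚᵘ.* q) ≡ fromℚᵘ p * fromℚᵘ q
fromℚᵘ-homo-* p q = toℚᵘ-injective (ℚᵘ.≃-trans (toℚᵘ-fromℚᵘ _)
  (ℚᵘ.≃-trans (ℚᵘ.*-cong (ℚᵘ.≃-sym (toℚᵘ-fromℚᵘ p)) (ℚᵘ.≃-sym (toℚᵘ-fromℚᵘ q)))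
              (ℚᵘ.≃-sym (toℚᵘ-homo-* (fromℚᵘ p) (fromℚᵘ q)))))

fromℚᵘ-cross : ∀ p q → ℚᵘ.↥ p ℤ.* ℚᵘ.↧ q ≡ ℚᵘ.↥ q ℤ.* ℚᵘ.↧ p → fromℚᵘ p ≡ fromℚᵘ q
fromℚᵘ-cross p q eq = fromℚᵘ-cong {p} {q} (ℚᵘ.*≡* eq)

fromℕᵘ : ℕ → ℚᵘ.ℚᵘ
fromℕᵘ n = ℚᵘ.mkℚᵘ (+ n) 0

-- fromℕ n, recip (suc d) and + a / suc d are fromℚᵘ of fromℕᵘ n, mkℚᵘ (+ 1) d and
-- mkℚᵘ (+ a) d, so these identities reduce to cross-multiplications in ℤ.
fromℕ-+ : ∀ a b → fromℕ (a ℕ.+ b) ≡ fromℕ a + fromℕ b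
fromℕ-+ a b =
  trans (fromℚᵘ-cross (fromℕᵘ (a ℕ.+ b)) (fromℕᵘ a ℚᵘ.+ fromℕᵘ b) cross)
        (fromℚᵘ-homo-+ (fromℕᵘ a) (fromℕᵘ b))
  where
  normalise : ∀ x y → (x ℤ.+ y) ℤ.* + 1 ≡ (x ℤ.* + 1 ℤ.+ y ℤ.* + 1) ℤ.* + 1
  normalise = solve-∀
  cross : + (a ℕ.+ b) ℤ.* + 1 ≡ (+ a ℤ.* + 1 ℤ.+ + b ℤ.* + 1) ℤ.* + 1
  cross rewrite ℤ.pos-+ a b = normalise (+ a) (+ b)

fromℕ-* : ∀ a b → fromℕ (a ℕ.* b) ≡ fromℕ a * fromℕ b
fromℕ-* a b =
  trans (fromℚᵘ-cross (fromℕᵘ (a ℕ.* b)) (fromℕᵘ a ℚᵘ.* fromℕᵘ b) cross)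
        (fromℚᵘ-homo-* (fromℕᵘ a) (fromℕᵘ b))
  where
  cross : + (a ℕ.* b) ℤ.* + 1 ≡ (+ a ℤ.* + b) ℤ.* + 1
  cross = cong (ℤ._* + 1) (ℤ.pos-* a b)

fromℕ-suc : ∀ n → fromℕ (suc n) ≡ 1ℚ + fromℕ n
fromℕ-suc = fromℕ-+ 1

fromℕ*recip : ∀ n → fromℕ (suc n) * recip (suc n) ≡ 1ℚ
fromℕ*recip n =
  trans (sym (fromℚᵘ-homo-* (fromℕᵘ (suc n)) (ℚᵘ.mkℚᵘ (+ 1) n)))
        (fromℚᵘ-cross (fromℕᵘ (suc n) ℚᵘ.* ℚᵘ.mkℚᵘ (+ 1) n) (fromℕᵘ 1) cross)
  where
  normalise : ∀ x → (x ℤ.* + 1) ℤ.* + 1 ≡ + 1 ℤ.* (+ 1 ℤ.* x)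
  normalise = solve-∀
  cross : (+ suc n ℤ.* + 1) ℤ.* + 1 ≡ + 1 ℤ.* + (1 ℕ.* suc n)
  cross rewrite ℤ.pos-* 1 (suc n) = normalise (+ suc n)

/≡fromℕ*recip : ∀ a d → + a / suc d ≡ fromℕ a * recip (suc d)
/≡fromℕ*recip a d =
  trans (fromℚᵘ-cross (ℚᵘ.mkℚᵘ (+ a) d) (fromℕᵘ a ℚᵘ.* ℚᵘ.mkℚᵘ (+ 1) d) cross)
        (fromℚᵘ-homo-* (fromℕᵘ a) (ℚᵘ.mkℚᵘ (+ 1) d))
  where
  normalise : ∀ x y → x ℤ.* (+ 1 ℤ.* y) ≡ (x ℤ.* + 1) ℤ.* y
  normalise = solve-∀
  cross : + a ℤ.* + (1 ℕ.* suc d) ≡ (+ a ℤ.* + 1) ℤ.* + suc d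
  cross rewrite ℤ.pos-* 1 (suc d) = normalise (+ a) (+ suc d)

∑ : ℕ → (ℕ → ℚ) → ℚ
∑ zero    f = 0ℚ
∑ (suc N) f = ∑ N f + f N

syntax ∑ N (λ i → e) = ∑[ i < N ] e

∑-cong : ∀ N {f g : ℕ → ℚ} → (∀ i → i < N → f i ≡ g i) → ∑ N f ≡ ∑ N g
∑-cong zero    f≡g = refl
∑-cong (suc N) f≡g = cong₂ _+_ (∑-cong N (λ i i<N → f≡g i (ℕ.m<n⇒m<1+n i<N))) (f≡g N (ℕ.n<1+n N))

∑-zero : ∀ N → ∑[ _ < N ] 0ℚ ≡ 0ℚ
∑-zero zero    = refl
∑-zero (suc N) rewrite ∑-zero N = refl

∑-const : ∀ N c → ∑[ _ < N ] c ≡ fromℕ N * c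
∑-const zero    c = sym (*-zeroˡ c)
∑-const (suc N) c rewrite ∑-const N c | fromℕ-suc N = ring (fromℕ N) c
  where
  ring : ∀ x c → x * c + c ≡ (1ℚ + x) * c
  ring = solve 2 (λ x c → x :* c :+ c := (con 1ℚ :+ x) :* c) refl

∑-+ : ∀ N f g → ∑[ i < N ] (f i + g i) ≡ ∑ N f + ∑ N g
∑-+ zero    f g = refl
∑-+ (suc N) f g rewrite ∑-+ N f g = ring (∑ N f) (∑ N g) (f N) (g N)
  where
  ring : ∀ a b c d → (a + b) + (c + d) ≡ (a + c) + (b + d)
  ring = solve 4 (λ a b c d → (a :+ b) :+ (c :+ d) := (a :+ c) :+ (b :+ d)) refl

∑-unroll-first : ∀ N f → ∑ (suc N) f ≡ f 0 + ∑ N (f ∘ suc)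
∑-unroll-first zero    f = trans (+-identityˡ (f 0)) (sym (+-identityʳ (f 0)))
∑-unroll-first (suc N) f = trans (cong (_+ f (suc N)) (∑-unroll-first N f)) (+-assoc (f 0) _ _)

∑-split : ∀ M N f → ∑ (M ℕ.+ N) f ≡ ∑ M f + ∑[ t < N ] f (M ℕ.+ t)
∑-split M zero    f rewrite ℕ.+-identityʳ M = sym (+-identityʳ (∑ M f))
∑-split M (suc N) f rewrite ℕ.+-suc M N | ∑-split M N f = +-assoc (∑ M f) _ _

∑-upper-triangle : ∀ N (f : ℕ → ℕ → ℚ) →
  ∑[ i < N ] ∑[ j < N ] (if i <ᵇ j then f i j else 0ℚ) ≡ ∑[ j < N ] ∑[ i < j ] f i j
∑-upper-triangle zero    f = refl
∑-upper-triangle (suc N) f = begin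
  ∑[ i < suc N ] (∑[ j < N ] g i j + g i N)
    ≡⟨ ∑-+ (suc N) (λ i → ∑[ j < N ] g i j) (λ i → g i N) ⟩
  (∑[ i < N ] ∑[ j < N ] g i j + ∑[ j < N ] g N j) + (∑[ i < N ] g i N + g N N)
    ≡⟨ cong₂ (λ u v → (∑[ i < N ] ∑[ j < N ] g i j + u) + v) last-row-vanishes (cong₂ _+_ last-column diagonal-vanishes) ⟩
  (∑[ i < N ] ∑[ j < N ] g i j + 0ℚ) + (∑[ i < N ] f i N + 0ℚ)
    ≡⟨ cong₂ _+_ (trans (+-identityʳ _) (∑-upper-triangle N f)) (+-identityʳ _) ⟩
  ∑[ j < N ] ∑[ i < j ] f i j + ∑[ i < N ] f i N ∎
  where
  open ≡-Reasoning
  g : ℕ → ℕ → ℚ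
  g i j = if i <ᵇ j then f i j else 0ℚ
  when-< : ∀ {i j} → i < j → g i j ≡ f i j
  when-< i<j rewrite Equivalence.to T-≡ (ℕ.<⇒<ᵇ i<j) = refl
  when-≮ : ∀ {i j} → ¬ (i < j) → g i j ≡ 0ℚ
  when-≮ {i} {j} i≮j with i <ᵇ j in eq
  ... | false = refl
  ... | true  = contradiction (ℕ.<ᵇ⇒< i j (subst T (sym eq) _)) i≮j
  last-row-vanishes : ∑[ j < N ] g N j ≡ 0ℚ
  last-row-vanishes = trans (∑-cong N (λ j j<N → when-≮ (ℕ.<⇒≯ j<N))) (∑-zero N)
  last-column : ∑[ i < N ] g i N ≡ ∑[ i < N ] f i N
  last-column = ∑-cong N (λ i i<N → when-< i<N)
  diagonal-vanishes : g N N ≡ 0ℚ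
  diagonal-vanishes = when-≮ (ℕ.n≮n N)

sumℚ-++ : ∀ xs ys → sumℚ (xs ++ ys) ≡ sumℚ xs + sumℚ ys
sumℚ-++ []       ys = sym (+-identityˡ _)
sumℚ-++ (x ∷ xs) ys rewrite sumℚ-++ xs ys = sym (+-assoc x _ _)

sumℚ-concatMap : ∀ {A B : Set} (F : B → ℚ) (f : A → List B) xs →
  sumℚ (map F (concatMap f xs)) ≡ sumℚ (map (λ x → sumℚ (map F (f x))) xs)
sumℚ-concatMap F f []       = refl
sumℚ-concatMap F f (x ∷ xs) = begin
  sumℚ (map F (f x ++ concatMap f xs))                ≡⟨ cong sumℚ (map-++ F (f x) (concatMap f xs)) ⟩
  sumℚ (map F (f x) ++ map F (concatMap f xs))        ≡⟨ sumℚ-++ (map F (f x)) _ ⟩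
  sumℚ (map F (f x)) + sumℚ (map F (concatMap f xs))  ≡⟨ cong (_+_ (sumℚ (map F (f x)))) (sumℚ-concatMap F f xs) ⟩
  sumℚ (map (λ x → sumℚ (map F (f x))) (x ∷ xs))      ∎
  where open ≡-Reasoning

sumℚ-tabulate : ∀ n (h : ℕ → ℚ) → sumℚ (tabulate {n = n} (h ∘ toℕ)) ≡ ∑ n h
sumℚ-tabulate zero    h = refl
sumℚ-tabulate (suc n) h = trans (cong (_+_ (h 0)) (sumℚ-tabulate n (h ∘ suc))) (sym (∑-unroll-first n h))

sumℚ-allFin : ∀ n (h : ℕ → ℚ) → sumℚ (map (h ∘ toℕ) (allFin n)) ≡ ∑ n h
sumℚ-allFin n h = trans (cong sumℚ (map-tabulate {n = n} (λ x → x) (h ∘ toℕ))) (sumℚ-tabulate n h)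

sumℚ-pairs : ∀ n (f : ℕ → ℕ → ℚ) →
  sumℚ (map (λ p → f (toℕ (proj₁ p)) (toℕ (proj₂ p))) (pairs n)) ≡ ∑[ j < n ] ∑[ i < j ] f i j
sumℚ-pairs n f = begin
  sumℚ (map F (pairs n))
    ≡⟨ sumℚ-concatMap F row (allFin n) ⟩
  sumℚ (map (λ x → sumℚ (map F (row x))) (allFin n))
    ≡⟨ cong sumℚ (map-cong row-sum (allFin n)) ⟩
  sumℚ (map (λ x → ∑[ j < n ] g (toℕ x) j) (allFin n))
    ≡⟨ sumℚ-allFin n (λ i → ∑[ j < n ] g i j) ⟩
  ∑[ i < n ] ∑[ j < n ] g i j
    ≡⟨ ∑-upper-triangle n f ⟩
  ∑[ j < n ] ∑[ i < j ] f i j ∎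
  where
  open ≡-Reasoning
  F : Fin n × Fin n → ℚ
  F p = f (toℕ (proj₁ p)) (toℕ (proj₂ p))
  g : ℕ → ℕ → ℚ
  g i j = if i <ᵇ j then f i j else 0ℚ
  entry : Fin n → Fin n → List (Fin n × Fin n)
  entry x y = if toℕ x <ᵇ toℕ y then (x , y) ∷ [] else []
  row : Fin n → List (Fin n × Fin n)
  row x = concatMap (entry x) (allFin n)
  entry-sum : ∀ x y → sumℚ (map F (entry x y)) ≡ g (toℕ x) (toℕ y)
  entry-sum x y with toℕ x <ᵇ toℕ y
  ... | true  = +-identityʳ _
  ... | false = refl
  row-sum : ∀ x → sumℚ (map F (row x)) ≡ ∑[ j < n ] g (toℕ x) j
  row-sum x = trans (sumℚ-concatMap F (entry x) (allFin n))
                    (trans (cong sumℚ (map-cong (entry-sum x) (allFin n))) (sumℚ-allFin n (g (toℕ x))))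

harmonic≡∑ : ∀ N → ∑[ i < N ] recip (suc i) ≡ harmonic N
harmonic≡∑ zero    = refl
harmonic≡∑ (suc N) = cong (_+ recip (suc N)) (harmonic≡∑ N)

harmonic≡∑-reversed : ∀ N → ∑[ i < N ] recip (N ∸ i) ≡ harmonic N
harmonic≡∑-reversed zero    = refl
harmonic≡∑-reversed (suc N) = begin
  ∑[ i < suc N ] recip (suc N ∸ i)    ≡⟨ ∑-unroll-first N (λ i → recip (suc N ∸ i)) ⟩
  recip (suc N) + ∑[ i < N ] recip (N ∸ i) ≡⟨ cong (_+_ (recip (suc N))) (harmonic≡∑-reversed N) ⟩
  recip (suc N) + harmonic N          ≡⟨ +-comm (recip (suc N)) (harmonic N) ⟩
  harmonic (suc N)                    ∎
  where open ≡-Reasoning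

≡-up-to-inverse : ∀ {p q a r} → a * r ≡ 1ℚ → p + (a * r - 1ℚ) ≡ q → p ≡ q
≡-up-to-inverse {p} {q} {a} {r} a*r≡1 p+[ar-1]≡q = begin
  p                  ≡⟨ ring p ⟨
  p + (1ℚ - 1ℚ)      ≡⟨ cong (λ e → p + (e - 1ℚ)) a*r≡1 ⟨
  p + (a * r - 1ℚ)   ≡⟨ p+[ar-1]≡q ⟩
  q                  ∎
  where
  open ≡-Reasoning
  ring : ∀ p → p + (1ℚ - 1ℚ) ≡ p
  ring = solve 1 (λ p → p :+ (con 1ℚ :- con 1ℚ) := p) refl

∑-harmonic : ∀ N → ∑[ j < N ] harmonic j ≡ fromℕ N * harmonic N - fromℕ N
∑-harmonic zero    = refl
∑-harmonic (suc N) rewrite ∑-harmonic N | fromℕ-suc N =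
  ≡-up-to-inverse {a = 1ℚ + fromℕ N} {r = recip (suc N)} inverse (ring (fromℕ N) (harmonic N) (recip (suc N)))
  where
  inverse : (1ℚ + fromℕ N) * recip (suc N) ≡ 1ℚ
  inverse = trans (cong (_* recip (suc N)) (sym (fromℕ-suc N))) (fromℕ*recip N)
  ring : ∀ x h r → ((x * h - x) + h) + ((1ℚ + x) * r - 1ℚ) ≡ (1ℚ + x) * (h + r) - (1ℚ + x)
  ring = solve 3 (λ x h r → ((x :* h :- x) :+ h) :+ ((con 1ℚ :+ x) :* r :- con 1ℚ)
                          := (con 1ℚ :+ x) :* (h :+ r) :- (con 1ℚ :+ x)) refl

suc[n]*n≡n*[n∸1]+2*n : ∀ n → suc n ℕ.* n ≡ n ℕ.* (n ∸ 1) ℕ.+ 2 ℕ.* n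
suc[n]*n≡n*[n∸1]+2*n zero    = refl
suc[n]*n≡n*[n∸1]+2*n (suc n) = ring n
  where
  ring : ∀ n → suc (suc n) ℕ.* suc n ≡ suc n ℕ.* n ℕ.+ 2 ℕ.* suc n
  ring = ℕ-solve-∀

∑-half : ∀ L → ∑[ t < L ] (fromℕ t * ½) ≡ fromℕ (L ℕ.* (L ∸ 1)) * ¼
∑-half zero    = refl
∑-half (suc L) rewrite ∑-half L | suc[n]*n≡n*[n∸1]+2*n L | fromℕ-+ (L ℕ.* (L ∸ 1)) (2 ℕ.* L) | fromℕ-* 2 L =
  sym (ring (fromℕ (L ℕ.* (L ∸ 1))) (fromℕ L) (fromℕ 2) ¼)
  where
  -- fromℕ 2 * ¼ reduces to ½ by computation
  ring : ∀ a b c d → (a + c * b) * d ≡ a * d + b * (c * d)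
  ring = solve 4 (λ a b c d → (a :+ c :* b) :* d := a :* d :+ b :* (c :* d)) refl

module ShortestPaths {n : ℕ} (G : Graph n) (d : Fin n → Fin n → ℕ)
  (d-refl : ∀ x → d x x ≡ 0)
  (d≡0⇒≡ : ∀ {x y} → d x y ≡ 0 → x ≡ y)
  (d-edge : ∀ {x y z} → T (G z y) → d x y ≤ suc (d x z))
  (d-pred : ∀ {x y k} → d x y ≡ suc k → ∃[ z ] T (G z y) × d x z ≡ k)
  where

  within-sound : ∀ k {x y} → T (within G k x y) → d x y ≤ k
  within-sound zero    {x} w = ℕ.≤-reflexive (trans (cong (d x) (sym (toℕ-injective (ℕ.≡ᵇ⇒≡ _ _ w)))) (d-refl x))
  within-sound (suc k) w with Equivalence.to T-∨ w
  ... | inj₁ w′ = ℕ.m≤n⇒m≤1+n (within-sound k w′)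
  ... | inj₂ w′ with satisfied (any⁻ _ (allFin n) w′)
  ... | z , walk-then-edge with Equivalence.to T-∧ walk-then-edge
  ... | walk , edge = ℕ.≤-trans (d-edge edge) (s≤s (within-sound k walk))

  within-complete : ∀ k {x y} → d x y ≤ k → T (within G k x y)
  within-complete zero    d≤0 = ℕ.≡⇒≡ᵇ _ _ (cong toℕ (d≡0⇒≡ (ℕ.n≤0⇒n≡0 d≤0)))
  within-complete (suc k) {x} {y} d≤ with ℕ.m≤n⇒m<n∨m≡n d≤
  ... | inj₁ d< = Equivalence.from T-∨ (inj₁ (within-complete k (ℕ.s≤s⁻¹ d<)))
  ... | inj₂ d≡ with d-pred d≡
  ... | z , edge , dz = Equivalence.from T-∨ (inj₂ (any⁺ _ (lose (∈-allFin z) walk-then-edge)))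
    where
    walk-then-edge : T (within G k x z ∧ G z y)
    walk-then-edge = Equivalence.from T-∧ (within-complete k (ℕ.≤-reflexive dz) , edge)

  leastFrom-correct : ∀ {x y} fuel k → k ≤ d x y → d x y < k ℕ.+ fuel → leastFrom G x y k fuel ≡ d x y
  leastFrom-correct {x} {y} zero       k k≤d d<k = contradiction (subst (d x y <_) (ℕ.+-identityʳ k) d<k) (ℕ.≤⇒≯ k≤d)
  leastFrom-correct {x} {y} (suc fuel) k k≤d d< with within G k x y in found
  ... | true  = ℕ.≤-antisym k≤d (within-sound k (subst T (sym found) _))
  ... | false = leastFrom-correct fuel (suc k) (ℕ.≤∧≢⇒< k≤d k≢d) (subst (d x y <_) (ℕ.+-suc k fuel) d<)
    where
    k≢d : k ≢ d x y
    k≢d k≡d = subst T found (within-complete k (ℕ.≤-reflexive (sym k≡d)))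

  dist-correct : ∀ x y → d x y < n → dist G x y ≡ d x y
  dist-correct x y d<n = leastFrom-correct n 0 z≤n d<n

data Adjacent (m : ℕ) : ℕ → ℕ → Set where
  path-up   : ∀ {i} → suc i ≤ m → Adjacent m i (suc i)
  path-down : ∀ {i} → suc i ≤ m → Adjacent m (suc i) i
  hub-leaf  : ∀ {j} → m < j → Adjacent m 0 j
  leaf-hub  : ∀ {j} → m < j → Adjacent m j 0

broomEdge-sound : ∀ n Δ i j → T (broomEdge n Δ i j) → (suc i ≡ j × j ≤ n ∸ Δ) ⊎ (i ≡ 0 × n ∸ Δ < j)
broomEdge-sound n Δ i j e with Equivalence.to T-∨ e
... | inj₁ e′ = let (e₁ , e₂) = Equivalence.to T-∧ e′ in inj₁ (ℕ.≡ᵇ⇒≡ _ _ e₁ , ℕ.≤ᵇ⇒≤ _ _ e₂)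
... | inj₂ e′ = let (e₁ , e₂) = Equivalence.to T-∧ e′ in inj₂ (ℕ.≡ᵇ⇒≡ _ _ e₁ , ℕ.<ᵇ⇒< _ _ e₂)

adjacent-sound : ∀ {n Δ} i j → T (broomEdge n Δ i j ∨ broomEdge n Δ j i) → Adjacent (n ∸ Δ) i j
adjacent-sound {n} {Δ} i j e with Equivalence.to T-∨ e
... | inj₁ e′ with broomEdge-sound n Δ i j e′
...   | inj₁ (refl , j≤m) = path-up j≤m
...   | inj₂ (refl , m<j) = hub-leaf m<j
adjacent-sound {n} {Δ} i j e | inj₂ e′ with broomEdge-sound n Δ j i e′
...   | inj₁ (refl , i≤m) = path-down i≤m
...   | inj₂ (refl , m<i) = leaf-hub m<i

T-∨ˡ : ∀ {a} b → T a → T (a ∨ b)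
T-∨ˡ b = Equivalence.from T-∨ ∘ inj₁

T-∨ʳ : ∀ a {b} → T b → T (a ∨ b)
T-∨ʳ a = Equivalence.from T-∨ ∘ inj₂

broomEdge-path : ∀ {n Δ i} → suc i ≤ n ∸ Δ → T (broomEdge n Δ i (suc i))
broomEdge-path {n} {Δ} {i} i<m =
  T-∨ˡ ((i ℕ.≡ᵇ 0) ∧ (n ∸ Δ <ᵇ suc i)) (Equivalence.from T-∧ (ℕ.≡⇒≡ᵇ (suc i) (suc i) refl , ℕ.≤⇒≤ᵇ i<m))

broomEdge-hub : ∀ {n Δ j} → n ∸ Δ < j → T (broomEdge n Δ 0 j)
broomEdge-hub {n} {Δ} {j} m<j = T-∨ʳ ((1 ℕ.≡ᵇ j) ∧ (j ℕ.≤ᵇ n ∸ Δ)) (ℕ.<⇒<ᵇ m<j)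

adjacent-complete : ∀ {n Δ i j} → Adjacent (n ∸ Δ) i j → T (broomEdge n Δ i j ∨ broomEdge n Δ j i)
adjacent-complete {n} {Δ} (path-up   {i} i<m) = T-∨ˡ (broomEdge n Δ (suc i) i) (broomEdge-path {n} {Δ} i<m)
adjacent-complete {n} {Δ} (path-down {i} i<m) = T-∨ʳ (broomEdge n Δ (suc i) i) (broomEdge-path {n} {Δ} i<m)
adjacent-complete {n} {Δ} (hub-leaf  {j} m<j) = T-∨ˡ (broomEdge n Δ j 0) (broomEdge-hub {n} {Δ} m<j)
adjacent-complete {n} {Δ} (leaf-hub  {j} m<j) = T-∨ʳ (broomEdge n Δ j 0) (broomEdge-hub {n} {Δ} m<j)

-- Vertices i ≤ m lie on the path 0 … m; vertices i > m are the extra leaves at the hub 0.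
broomDist : ℕ → ℕ → ℕ → ℕ
broomDist m i j with i ℕ.≤? m | j ℕ.≤? m
... | yes _ | yes _ = ℕ.∣ i - j ∣
... | yes _ | no  _ = suc i
... | no  _ | yes _ = suc j
... | no  _ | no  _ with i ℕ.≟ j
...   | yes _ = 0
...   | no  _ = 2

module _ {m i j : ℕ} where

  broomDist-path-path : i ≤ m → j ≤ m → broomDist m i j ≡ ℕ.∣ i - j ∣
  broomDist-path-path i≤m j≤m
    rewrite dec-yes-irr (i ℕ.≤? m) ℕ.≤-irrelevant i≤m | dec-yes-irr (j ℕ.≤? m) ℕ.≤-irrelevant j≤m = refl

  broomDist-path-leaf : i ≤ m → m < j → broomDist m i j ≡ suc i
  broomDist-path-leaf i≤m m<j
    rewrite dec-yes-irr (i ℕ.≤? m) ℕ.≤-irrelevant i≤m | dec-no (j ℕ.≤? m) (ℕ.<⇒≱ m<j) = refl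

  broomDist-leaf-path : m < i → j ≤ m → broomDist m i j ≡ suc j
  broomDist-leaf-path m<i j≤m
    rewrite dec-no (i ℕ.≤? m) (ℕ.<⇒≱ m<i) | dec-yes-irr (j ℕ.≤? m) ℕ.≤-irrelevant j≤m = refl

  broomDist-leaf-leaf : m < i → m < j → i ≢ j → broomDist m i j ≡ 2
  broomDist-leaf-leaf m<i m<j i≢j
    rewrite dec-no (i ℕ.≤? m) (ℕ.<⇒≱ m<i) | dec-no (j ℕ.≤? m) (ℕ.<⇒≱ m<j) | dec-no (i ℕ.≟ j) i≢j = refl

broomDist-leaf-self : ∀ {m i} → m < i → broomDist m i i ≡ 0
broomDist-leaf-self {m} {i} m<i
  rewrite dec-no (i ℕ.≤? m) (ℕ.<⇒≱ m<i) | dec-yes-irr (i ℕ.≟ i) ℕ.≡-irrelevant refl = refl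

broomDist-self : ∀ m x → broomDist m x x ≡ 0
broomDist-self m x with ℕ.≤-<-connex x m
... | inj₁ x≤m = trans (broomDist-path-path x≤m x≤m) (ℕ.∣n-n∣≡0 x)
... | inj₂ m<x = broomDist-leaf-self m<x

broomDist≡0⇒≡ : ∀ {m x y} → broomDist m x y ≡ 0 → x ≡ y
broomDist≡0⇒≡ {m} {x} {y} d≡0 with ℕ.≤-<-connex x m | ℕ.≤-<-connex y m
... | inj₁ x≤m | inj₁ y≤m = ℕ.∣m-n∣≡0⇒m≡n (trans (sym (broomDist-path-path x≤m y≤m)) d≡0)
... | inj₁ x≤m | inj₂ m<y = contradiction (trans (sym (broomDist-path-leaf x≤m m<y)) d≡0) ℕ.1+n≢0
... | inj₂ m<x | inj₁ y≤m = contradiction (trans (sym (broomDist-leaf-path m<x y≤m)) d≡0) ℕ.1+n≢0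
... | inj₂ m<x | inj₂ m<y with x ℕ.≟ y
...   | yes x≡y = x≡y
...   | no  x≢y = contradiction (trans (sym (broomDist-leaf-leaf m<x m<y x≢y)) d≡0) ℕ.1+n≢0

broomDist≤1+m : ∀ {m} x y → 1 ≤ m → broomDist m x y ≤ suc m
broomDist≤1+m {m} x y 1≤m with ℕ.≤-<-connex x m | ℕ.≤-<-connex y m
... | inj₁ x≤m | inj₁ y≤m rewrite broomDist-path-path x≤m y≤m =
  ℕ.m≤n⇒m≤1+n (ℕ.≤-trans (ℕ.∣m-n∣≤m⊔n x y) (ℕ.⊔-lub x≤m y≤m))
... | inj₁ x≤m | inj₂ m<y rewrite broomDist-path-leaf x≤m m<y = s≤s x≤m
... | inj₂ m<x | inj₁ y≤m rewrite broomDist-leaf-path m<x y≤m = s≤s y≤m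
... | inj₂ m<x | inj₂ m<y with x ℕ.≟ y
...   | yes refl rewrite broomDist-leaf-self m<x = z≤n
...   | no  x≢y  rewrite broomDist-leaf-leaf m<x m<y x≢y = s≤s 1≤m

∣m-suc[n]∣≤suc∣m-n∣ : ∀ m n → ℕ.∣ m - suc n ∣ ≤ suc ℕ.∣ m - n ∣
∣m-suc[n]∣≤suc∣m-n∣ zero    n       = ℕ.≤-refl
∣m-suc[n]∣≤suc∣m-n∣ (suc m) zero    rewrite ℕ.∣-∣-identityʳ m = ℕ.m≤n⇒m≤1+n (ℕ.n≤1+n m)
∣m-suc[n]∣≤suc∣m-n∣ (suc m) (suc n) = ∣m-suc[n]∣≤suc∣m-n∣ m n

∣m-n∣≤suc∣m-suc[n]∣ : ∀ m n → ℕ.∣ m - n ∣ ≤ suc ℕ.∣ m - suc n ∣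
∣m-n∣≤suc∣m-suc[n]∣ zero    n       = ℕ.m≤n⇒m≤1+n (ℕ.n≤1+n n)
∣m-n∣≤suc∣m-suc[n]∣ (suc m) zero    rewrite ℕ.∣-∣-identityʳ m = ℕ.≤-refl
∣m-n∣≤suc∣m-suc[n]∣ (suc m) (suc n) = ∣m-n∣≤suc∣m-suc[n]∣ m n

broomDist-edge : ∀ {m x y z} → Adjacent m z y → broomDist m x y ≤ suc (broomDist m x z)
broomDist-edge {m} {x} (path-up {z} z<m) with ℕ.≤-<-connex x m
... | inj₁ x≤m rewrite broomDist-path-path x≤m z<m | broomDist-path-path x≤m (ℕ.<⇒≤ z<m) = ∣m-suc[n]∣≤suc∣m-n∣ x z
... | inj₂ m<x rewrite broomDist-leaf-path m<x z<m | broomDist-leaf-path m<x (ℕ.<⇒≤ z<m) = ℕ.≤-refl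
broomDist-edge {m} {x} (path-down {y} y<m) with ℕ.≤-<-connex x m
... | inj₁ x≤m rewrite broomDist-path-path x≤m y<m | broomDist-path-path x≤m (ℕ.<⇒≤ y<m) = ∣m-n∣≤suc∣m-suc[n]∣ x y
... | inj₂ m<x rewrite broomDist-leaf-path m<x y<m | broomDist-leaf-path m<x (ℕ.<⇒≤ y<m) =
  ℕ.m≤n⇒m≤1+n (ℕ.n≤1+n (suc y))
broomDist-edge {m} {x} (hub-leaf {y} m<y) with ℕ.≤-<-connex x m
... | inj₁ x≤m rewrite broomDist-path-leaf x≤m m<y | broomDist-path-path x≤m (z≤n {m}) | ℕ.∣-∣-identityʳ x = ℕ.≤-refl
... | inj₂ m<x rewrite broomDist-leaf-path m<x (z≤n {m}) with x ℕ.≟ y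
...   | yes refl rewrite broomDist-leaf-self m<x = z≤n
...   | no  x≢y  rewrite broomDist-leaf-leaf m<x m<y x≢y = ℕ.≤-refl
broomDist-edge {m} {x} (leaf-hub {z} m<z) with ℕ.≤-<-connex x m
... | inj₁ x≤m rewrite broomDist-path-leaf x≤m m<z | broomDist-path-path x≤m (z≤n {m}) | ℕ.∣-∣-identityʳ x =
  ℕ.m≤n⇒m≤1+n (ℕ.n≤1+n x)
... | inj₂ m<x rewrite broomDist-leaf-path m<x (z≤n {m}) = s≤s z≤n

∣m-suc[n]∣≡suc∣m-n∣ : ∀ {m n} → m ≤ n → ℕ.∣ m - suc n ∣ ≡ suc ℕ.∣ m - n ∣
∣m-suc[n]∣≡suc∣m-n∣ z≤n       = refl
∣m-suc[n]∣≡suc∣m-n∣ (s≤s m≤n) = ∣m-suc[n]∣≡suc∣m-n∣ m≤n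

∣m-n∣≡suc∣m-suc[n]∣ : ∀ {m n} → n < m → ℕ.∣ m - n ∣ ≡ suc ℕ.∣ m - suc n ∣
∣m-n∣≡suc∣m-suc[n]∣ {suc m} {zero}  _         = cong suc (sym (ℕ.∣-∣-identityʳ m))
∣m-n∣≡suc∣m-suc[n]∣ {suc m} {suc n} (s≤s n<m) = ∣m-n∣≡suc∣m-suc[n]∣ n<m

Predecessor : ℕ → ℕ → ℕ → ℕ → Set
Predecessor m x y k = ∃[ z ] (z ≤ x ⊎ z ≤ y) × Adjacent m z y × broomDist m x z ≡ k

path-predecessor : ∀ {m x y k} → x ≤ m → y ≤ m → ℕ.∣ x - y ∣ ≡ suc k → Predecessor m x y k
path-predecessor {m} {x} {y} x≤m y≤m eq with ℕ.<-cmp x y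
path-predecessor {m} {x} {zero}  x≤m y≤m eq | tri< () _ _
path-predecessor {m} {x} {suc y} x≤m y<m eq | tri< (s≤s x≤y) _ _ =
  y , inj₂ (ℕ.n≤1+n y) , path-up y<m ,
  trans (broomDist-path-path x≤m (ℕ.<⇒≤ y<m)) (ℕ.suc-injective (trans (sym (∣m-suc[n]∣≡suc∣m-n∣ x≤y)) eq))
... | tri≈ _ refl _ = contradiction (trans (sym (ℕ.∣n-n∣≡0 x)) eq) ℕ.0≢1+n
... | tri> _ _ y<x =
  suc y , inj₁ y<x , path-down (ℕ.≤-trans y<x x≤m) ,
  trans (broomDist-path-path x≤m (ℕ.≤-trans y<x x≤m)) (ℕ.suc-injective (trans (sym (∣m-n∣≡suc∣m-suc[n]∣ y<x)) eq))

broomDist-predecessor : ∀ {m x y k} → broomDist m x y ≡ suc k → Predecessor m x y k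
broomDist-predecessor {m} {x} {y} eq with ℕ.≤-<-connex x m | ℕ.≤-<-connex y m
... | inj₁ x≤m | inj₁ y≤m = path-predecessor x≤m y≤m (trans (sym (broomDist-path-path x≤m y≤m)) eq)
... | inj₁ x≤m | inj₂ m<y =
  0 , inj₁ z≤n , hub-leaf m<y ,
  trans (trans (broomDist-path-path x≤m z≤n) (ℕ.∣-∣-identityʳ x))
        (ℕ.suc-injective (trans (sym (broomDist-path-leaf x≤m m<y)) eq))
... | inj₂ m<x | inj₂ m<y with x ℕ.≟ y
...   | yes refl = contradiction (trans (sym (broomDist-leaf-self m<x)) eq) ℕ.0≢1+n
...   | no  x≢y  =
  0 , inj₁ z≤n , hub-leaf m<y ,
  trans (broomDist-leaf-path m<x z≤n) (ℕ.suc-injective (trans (sym (broomDist-leaf-leaf m<x m<y x≢y)) eq))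
broomDist-predecessor {m} {x} {zero} eq | inj₂ m<x | inj₁ _ =
  x , inj₁ ℕ.≤-refl , leaf-hub m<x ,
  trans (broomDist-leaf-self m<x) (ℕ.suc-injective (trans (sym (broomDist-leaf-path m<x z≤n)) eq))
broomDist-predecessor {m} {x} {suc y} eq | inj₂ m<x | inj₁ y<m =
  y , inj₂ (ℕ.n≤1+n y) , path-up y<m ,
  trans (broomDist-leaf-path m<x (ℕ.<⇒≤ y<m)) (ℕ.suc-injective (trans (sym (broomDist-leaf-path m<x y<m)) eq))

broom-dist : ∀ n Δ → 1 ≤ n ∸ Δ → suc (n ∸ Δ) < n →
  ∀ x y → dist (broom n Δ) x y ≡ broomDist (n ∸ Δ) (toℕ x) (toℕ y)
broom-dist n Δ 1≤m m<n x y = dist-correct x y (ℕ.≤-<-trans (broomDist≤1+m (toℕ x) (toℕ y) 1≤m) m<n)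
  where
  m : ℕ
  m = n ∸ Δ
  d : Fin n → Fin n → ℕ
  d x y = broomDist m (toℕ x) (toℕ y)
  predecessor : ∀ {x y k} → d x y ≡ suc k → ∃[ z ] T (broom n Δ z y) × d x z ≡ k
  predecessor {x} {y} eq with broomDist-predecessor eq
  ... | z , z≤x⊎z≤y , z~y , dz =
    fromℕ< z<n , adjacent-complete {n} {Δ} z~y′ , trans (cong (broomDist m (toℕ x)) toℕz≡z) dz
    where
    z<n : z < n
    z<n = [ (λ z≤x → ℕ.≤-<-trans z≤x (toℕ<n x)) , (λ z≤y → ℕ.≤-<-trans z≤y (toℕ<n y)) ] z≤x⊎z≤y
    toℕz≡z : toℕ (fromℕ< z<n) ≡ z
    toℕz≡z = toℕ-fromℕ< z<n
    z~y′ : Adjacent m (toℕ (fromℕ< z<n)) (toℕ y)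
    z~y′ = subst (λ w → Adjacent m w (toℕ y)) (sym toℕz≡z) z~y
  open ShortestPaths (broom n Δ) d (λ x → broomDist-self m (toℕ x))
                     (λ {x} {y} e → toℕ-injective (broomDist≡0⇒≡ {m} {toℕ x} {toℕ y} e))
                     (λ {x} {y} {z} e → broomDist-edge {m} {toℕ x} (adjacent-sound {n} {Δ} (toℕ z) (toℕ y) e))
                     (λ {x} {y} {k} → predecessor {x} {y} {k})

column : ℕ → ℕ → ℚ
column m j = ∑[ i < j ] recip (broomDist m i j)

harary-broom : ∀ n Δ → 1 ≤ n ∸ Δ → suc (n ∸ Δ) < n → harary (broom n Δ) ≡ ∑[ j < n ] column (n ∸ Δ) j
harary-broom n Δ 1≤m m<n =
  trans (cong sumℚ (map-cong (λ p → cong recip (broom-dist n Δ 1≤m m<n (proj₁ p) (proj₂ p))) (pairs n)))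
        (sumℚ-pairs n (λ i j → recip (broomDist (n ∸ Δ) i j)))

column-path : ∀ {m j} → j ≤ m → column m j ≡ harmonic j
column-path {m} {j} j≤m = trans (∑-cong j distance) (harmonic≡∑-reversed j)
  where
  distance : ∀ i → i < j → recip (broomDist m i j) ≡ recip (j ∸ i)
  distance i i<j = cong recip (trans (broomDist-path-path (ℕ.≤-trans (ℕ.<⇒≤ i<j) j≤m) j≤m)
                                     (ℕ.m≤n⇒∣m-n∣≡n∸m (ℕ.<⇒≤ i<j)))

column-leaf : ∀ m t → column m (suc m ℕ.+ t) ≡ harmonic (suc m) + fromℕ t * ½
column-leaf m t = begin
  ∑[ i < suc m ℕ.+ t ] recip (broomDist m i j)
    ≡⟨ ∑-split (suc m) t (λ i → recip (broomDist m i j)) ⟩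
  ∑[ i < suc m ] recip (broomDist m i j) + ∑[ s < t ] recip (broomDist m (suc m ℕ.+ s) j)
    ≡⟨ cong₂ _+_ (∑-cong (suc m) to-path) (∑-cong t to-leaf) ⟩
  ∑[ i < suc m ] recip (suc i) + ∑[ _ < t ] ½
    ≡⟨ cong₂ _+_ (harmonic≡∑ (suc m)) (∑-const t ½) ⟩
  harmonic (suc m) + fromℕ t * ½ ∎
  where
  open ≡-Reasoning
  j : ℕ
  j = suc m ℕ.+ t
  m<j : m < j
  m<j = s≤s (ℕ.m≤m+n m t)
  to-path : ∀ i → i < suc m → recip (broomDist m i j) ≡ recip (suc i)
  to-path i (s≤s i≤m) = cong recip (broomDist-path-leaf i≤m m<j)
  to-leaf : ∀ s → s < t → recip (broomDist m (suc m ℕ.+ s) j) ≡ ½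
  to-leaf s s<t = cong recip (broomDist-leaf-leaf (s≤s (ℕ.m≤m+n m s)) m<j
                                (ℕ.<⇒≢ (ℕ.+-monoʳ-< (suc m) s<t)))

path-columns : ∀ m → ∑[ j < suc m ] column m j ≡ fromℕ (suc m) * harmonic (suc m) - fromℕ (suc m)
path-columns m = trans (∑-cong (suc m) (λ j j<1+m → column-path (ℕ.s≤s⁻¹ j<1+m))) (∑-harmonic (suc m))

leaf-columns : ∀ m L → ∑[ t < L ] column m (suc m ℕ.+ t)
                     ≡ fromℕ L * harmonic (suc m) + fromℕ (L ℕ.* (L ∸ 1)) * ¼
leaf-columns m L = begin
  ∑[ t < L ] column m (suc m ℕ.+ t)                      ≡⟨ ∑-cong L (λ t _ → column-leaf m t) ⟩
  ∑[ t < L ] (harmonic (suc m) + fromℕ t * ½)            ≡⟨ ∑-+ L (λ _ → harmonic (suc m)) (λ t → fromℕ t * ½) ⟩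
  ∑[ _ < L ] harmonic (suc m) + ∑[ t < L ] (fromℕ t * ½) ≡⟨ cong₂ _+_ (∑-const L (harmonic (suc m))) (∑-half L) ⟩
  fromℕ L * harmonic (suc m) + fromℕ (L ℕ.* (L ∸ 1)) * ¼ ∎
  where open ≡-Reasoning

closed-form : ∀ n m L X → n ≡ suc m ℕ.+ L →
  (fromℕ (suc m) * harmonic (suc m) - fromℕ (suc m)) + (fromℕ L * harmonic (suc m) + fromℕ X * ¼)
    ≡ fromℕ n * harmonic m - fromℕ n + fromℕ (suc L) + (+ X) / 4 + (+ L) / suc m
closed-form n m L X refl
  rewrite fromℕ-+ (suc m) L | fromℕ-suc L | /≡fromℕ*recip X 3 | /≡fromℕ*recip L m =
  sym (≡-up-to-inverse {a = fromℕ (suc m)} {r = recip (suc m)} (fromℕ*recip m)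
        (ring (fromℕ (suc m)) (fromℕ L) (harmonic m) (recip (suc m)) (fromℕ X) ¼))
  where
  ring : ∀ a l h r x q →
    ((a + l) * h - (a + l) + (1ℚ + l) + x * q + l * r) + (a * r - 1ℚ)
      ≡ (a * (h + r) - a) + (l * (h + r) + x * q)
  ring = solve 6 (λ a l h r x q →
    ((a :+ l) :* h :- (a :+ l) :+ (con 1ℚ :+ l) :+ x :* q :+ l :* r) :+ (a :* r :- con 1ℚ)
      := (a :* (h :+ r) :- a) :+ (l :* (h :+ r) :+ x :* q)) refl

lemma3p9 : (n Δ : ℕ) → 2 ≤ Δ → Δ ≤ n ∸ 1 →
    harary (broom n Δ)
      ≡ ((+ n) / 1) * harmonic (n ∸ Δ) - (+ n) / 1 + (+ Δ) / 1
        + (+ ((Δ ∸ 1) Data.Nat.* (Δ ∸ 2))) / 4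
        + (+ (Δ ∸ 1)) / (Data.Nat.suc (n ∸ Δ))
lemma3p9 zero    (suc (suc k)) (s≤s (s≤s z≤n)) ()
lemma3p9 (suc n) (suc (suc k)) (s≤s (s≤s z≤n)) 1+L<n = begin
  harary (broom (suc n) Δ)                                       ≡⟨ harary-broom (suc n) Δ 1≤m (s≤s m<n) ⟩
  ∑[ j < suc n ] column m j                                      ≡⟨ cong (λ N → ∑ N (column m)) (cong suc n≡m+L) ⟩
  ∑[ j < suc m ℕ.+ L ] column m j                                ≡⟨ ∑-split (suc m) L (column m) ⟩
  ∑[ j < suc m ] column m j + ∑[ t < L ] column m (suc m ℕ.+ t)  ≡⟨ cong₂ _+_ (path-columns m) (leaf-columns m L) ⟩
  (fromℕ (suc m) * harmonic (suc m) - fromℕ (suc m)) + (fromℕ L * harmonic (suc m) + fromℕ (L ℕ.* k) * ¼)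
                                                                 ≡⟨ closed-form (suc n) m L (L ℕ.* k) (cong suc n≡m+L) ⟩
  fromℕ (suc n) * harmonic m - fromℕ (suc n) + fromℕ Δ + (+ (L ℕ.* k)) / 4 + (+ L) / suc m ∎
  where
  open ≡-Reasoning
  L Δ m : ℕ
  L = suc k
  Δ = suc L
  m = n ∸ L
  n≡m+L : n ≡ m ℕ.+ L
  n≡m+L = sym (ℕ.m∸n+n≡m (ℕ.<⇒≤ 1+L<n))
  1≤m : 1 ≤ m
  1≤m = ℕ.m<n⇒0<n∸m 1+L<n
  m<n : m < n
  m<n = subst (m <_) (sym n≡m+L) (ℕ.m<m+n m (s≤s z≤n))
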